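{- Let $G^s_\mu=(V_{\mu},E^s,\sigma,\mu)$ and $H^s_{\mu_l}=(V_{\mu_l},E_l^s,\sigma_l,\mu_l)$, $l=1,\dots,n$, be structurally balanced signed graphs. Then $G^s_{\mu}\circ \overset{n}{\underset{l=1}{\Lambda}}H^s_{\mu_l}$ is unbalanced if there exists at least one $H^s_{\mu_j}$, $1\le j\le n$, having one of the following types of edges: (1) a positive edge that connects two oppositely marked nodes; (2) a negative edge that connects two negatively marked nodes; (3) a negative edge that connects two positively marked nodes.
   Context: A signed graph $G^s=(V,E^s,\sigma)$ has signature $\sigma:E^s\to\{+,-\}$; it is regarded as a marked graph with the canonical marking $\mu(v)=\prod_{e\ni v}\sigma(e)$. A cycle is balanced if it contains an even number of negative edges; a signed graph is balanced if all its cycles are balanced. $G^s_\mu$ has $n$ vertices. The generalized corona product $G^s_{\mu}\circ \overset{n}{\underset{l=1}{\Lambda}}H^s_{\mu_l}$ is obtained from disjoint copies of $G^s_\mu$ and all $H^s_{\mu_l}$ by joining the $l$-th vertex $u$ of $G^s_\mu$ to every vertex $v$ of $H^s_{\mu_l}$ with an edge of sign $\mu(u)\mu_l(v)$. -}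

module Defs where

open import Data.Nat using (ℕ; _≤_; _%_)
open import Data.Fin using (Fin; _≟_)
open import Data.Sign using (Sign; _*_) renaming (+ to pos; - to neg)
import Data.Sign as S
open import Data.Maybe using (Maybe; just; nothing; maybe′)
open import Data.List using (List; []; _∷_; length; filter; foldr; allFin)
open import Data.List.Relation.Unary.Unique.Propositional using (Unique)
open import Data.Product using (Σ; _,_)
open import Data.Sum using (_⊎_; inj₁; inj₂)
open import Relation.Binary.PropositionalEquality using (_≡_; refl)
open import Relation.Nullary using (yes; no)

-- A (possibly infinite-typed) signed adjacency: nothing = no edge, just s = edge of sign s.
Adj : Set → Set
Adj V = V → V → Maybe Sign

record SignedGraph (n : ℕ) : Set where
  field
    adj      : Adj (Fin n)
    sym      : ∀ i j → adj i j ≡ adj j i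
    loopless : ∀ i → adj i i ≡ nothing
open SignedGraph public

-- Canonical marking μ(v) = product of the signs of the edges incident to v.
marking : ∀ {n} → SignedGraph n → Fin n → Sign
marking G v = foldr (λ w acc → maybe′ (λ s → s * acc) acc (adj G v w)) pos (allFin _)

-- Signs of the edges of the closed walk v₀ v₁ … v_{k-1} v₀, if all these edges exist.
private
  step : ∀ {V} → Adj V → V → V → Maybe (List Sign) → Maybe (List Sign)
  step A x y r with A x y | r
  ... | just s | just ss = just (s ∷ ss)
  ... | _      | _       = nothing

  pathSigns : ∀ {V} → Adj V → V → V → List V → Maybe (List Sign)
  pathSigns A f x []       = step A x f (just [])
  pathSigns A f x (y ∷ ys) = step A x y (pathSigns A f y ys)

cycleSigns : ∀ {V} → Adj V → List V → Maybe (List Sign)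
cycleSigns A []       = nothing
cycleSigns A (v ∷ vs) = pathSigns A v v vs


numNeg : List Sign → ℕ
numNeg ss = length (filter (λ s → s S.≟ neg) ss)

-- A cycle is a list of k ≥ 3 distinct vertices, consecutive ones (cyclically) adjacent.
-- Balanced: every cycle has an even number of negative edges.
BalancedAdj : ∀ {V} → Adj V → Set
BalancedAdj {V} A = ∀ (vs : List V) (ss : List Sign) → Unique vs → 3 ≤ length vs →
  cycleSigns A vs ≡ just ss → numNeg ss % 2 ≡ 0

Balanced : ∀ {n} → SignedGraph n → Set
Balanced G = BalancedAdj (adj G)

CoronaV : (n : ℕ) → (Fin n → ℕ) → Set
CoronaV n m = Fin n ⊎ Σ (Fin n) (λ l → Fin (m l))

corona : ∀ {n} {m : Fin n → ℕ} → SignedGraph n → ((l : Fin n) → SignedGraph (m l)) →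
         Adj (CoronaV n m)
corona G H (inj₁ i) (inj₁ j) = adj G i j
corona G H (inj₁ u) (inj₂ (l , w)) with u ≟ l
... | yes refl = just (marking G u * marking (H u) w)
... | no _     = nothing
corona G H (inj₂ (l , w)) (inj₁ u) with u ≟ l
... | yes refl = just (marking G u * marking (H u) w)
... | no _     = nothing
corona G H (inj₂ (l , v)) (inj₂ (l′ , w)) with l ≟ l′
... | yes refl = adj (H l) v w
... | no _     = nothing

SpecialEdge : ∀ {k} → SignedGraph k → Set
SpecialEdge {k} H = Σ (Fin k) λ v → Σ (Fin k) λ w →
  (adj H v w ≡ just pos × (marking H v ≡ S.opposite (marking H w)))
  ⊎ (adj H v w ≡ just neg × marking H v ≡ neg × marking H w ≡ neg)
  ⊎ (adj H v w ≡ just neg × marking H v ≡ pos × marking H w ≡ pos)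
  where open import Data.Product using (_×_)

{-# OPTIONS --safe #-}
-- Let vw be an edge of H_j whose sign differs from μ_j(v)μ_j(w); the three edge types
-- of the theorem are exactly the three ways this can happen.  With u the j-th vertex
-- of G, the triangle u v w of the corona has sign
-- μ(u)μ_j(v) · σ_j(vw) · μ(u)μ_j(w) = σ_j(vw)μ_j(v)μ_j(w) = −, so it is an unbalanced
-- cycle.
module Submission where

open import Defs
open import Data.Fin using (Fin; _≟_)
open import Data.List using (List; []; _∷_; foldr; length)
open import Data.List.Relation.Unary.All using ([]; _∷_)
open import Data.List.Relation.Unary.AllPairs using ([]; _∷_)
open import Data.List.Relation.Unary.Unique.Propositional using (Unique)
open import Data.Maybe using (just)
open import Data.Nat using (ℕ; _+_; _≤_; _%_; s≤s; z≤n)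
open import Data.Nat.DivMod using (%-distribˡ-+)
open import Data.Product using (Σ; ∃; _,_; _×_)
open import Data.Sign using (Sign; _*_; opposite) renaming (+ to pos; - to neg)
open import Data.Sign.Properties using (*-identityʳ; s*s≡+; opposite[s]*s≡-; *-commutativeSemigroup)
open import Algebra.Properties.CommutativeSemigroup *-commutativeSemigroup
  using (x∙yz≈y∙xz; interchange)
open import Data.Sum using (inj₁; inj₂)
open import Relation.Binary.PropositionalEquality
  using (_≡_; _≢_; refl; cong; cong₂; trans; module ≡-Reasoning)
  renaming (sym to ≡-sym)
open import Relation.Nullary using (¬_; yes; no)

open ≡-Reasoning

signProduct : List Sign → Sign
signProduct = foldr _*_ pos

parity : Sign → ℕ
parity pos = 0
parity neg = 1

parity-opposite : ∀ s → (1 + parity s) % 2 ≡ parity (opposite s)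
parity-opposite pos = refl
parity-opposite neg = refl

numNeg%2≡parity∘signProduct : ∀ ss → numNeg ss % 2 ≡ parity (signProduct ss)
numNeg%2≡parity∘signProduct []         = refl
numNeg%2≡parity∘signProduct (pos ∷ ss) = numNeg%2≡parity∘signProduct ss
numNeg%2≡parity∘signProduct (neg ∷ ss) = begin
  (1 + numNeg ss) % 2                    ≡⟨ %-distribˡ-+ 1 (numNeg ss) 2 ⟩
  (1 + numNeg ss % 2) % 2                ≡⟨ cong (λ k → (1 + k) % 2) (numNeg%2≡parity∘signProduct ss) ⟩
  (1 + parity (signProduct ss)) % 2      ≡⟨ parity-opposite (signProduct ss) ⟩
  parity (opposite (signProduct ss))     ∎

parity≡0⇒pos : ∀ {s} → parity s ≡ 0 → s ≡ pos
parity≡0⇒pos {pos} _ = refl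

balanced⇒cycle-positive : ∀ {V} {A : Adj V} → BalancedAdj A →
  ∀ {vs ss} → Unique vs → 3 ≤ length vs → cycleSigns A vs ≡ just ss → signProduct ss ≡ pos
balanced⇒cycle-positive balanced {ss = ss} unique long cycle = parity≡0⇒pos (begin
  parity (signProduct ss)  ≡⟨ ≡-sym (numNeg%2≡parity∘signProduct ss) ⟩
  numNeg ss % 2            ≡⟨ balanced _ ss unique long cycle ⟩
  0                        ∎)

cycleSigns-triangle : ∀ {V} (A : Adj V) {a b c : V} {x y z} →
  A a b ≡ just x → A b c ≡ just y → A c a ≡ just z →
  cycleSigns A (a ∷ b ∷ c ∷ []) ≡ just (x ∷ y ∷ z ∷ [])
cycleSigns-triangle A ab bc ca rewrite ab | bc | ca = refl

unique-triple : ∀ {V : Set} {a b c : V} → a ≢ b → a ≢ c → b ≢ c → Unique (a ∷ b ∷ c ∷ [])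
unique-triple a≢b a≢c b≢c = (a≢b ∷ a≢c ∷ []) ∷ (b≢c ∷ []) ∷ [] ∷ []

balanced⇒triangle-positive : ∀ {V} {A : Adj V} → BalancedAdj A →
  ∀ {a b c : V} {x y z} → a ≢ b → a ≢ c → b ≢ c →
  A a b ≡ just x → A b c ≡ just y → A c a ≡ just z → signProduct (x ∷ y ∷ z ∷ []) ≡ pos
balanced⇒triangle-positive {A = A} balanced a≢b a≢c b≢c ab bc ca =
  balanced⇒cycle-positive balanced (unique-triple a≢b a≢c b≢c) (s≤s (s≤s (s≤s z≤n)))
    (cycleSigns-triangle A ab bc ca)

adjacent⇒distinct : ∀ {k} (H : SignedGraph k) {v w e} → adj H v w ≡ just e → v ≢ w
adjacent⇒distinct H {v} vw refl with trans (≡-sym vw) (loopless H v)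
... | ()

specialEdge⇒frustrated : ∀ {k} (H : SignedGraph k) → SpecialEdge H →
  Σ (Fin k) λ v → Σ (Fin k) λ w → Σ Sign λ e →
    adj H v w ≡ just e × e * (marking H v * marking H w) ≡ neg
specialEdge⇒frustrated H (v , w , inj₁ (vw , v≡-w)) =
  v , w , pos , vw , trans (cong (_* marking H w) v≡-w) (opposite[s]*s≡- (marking H w))
specialEdge⇒frustrated H (v , w , inj₂ (inj₁ (vw , v≡neg , w≡neg))) =
  v , w , neg , vw , cong₂ (λ a b → neg * (a * b)) v≡neg w≡neg
specialEdge⇒frustrated H (v , w , inj₂ (inj₂ (vw , v≡pos , w≡pos))) =
  v , w , neg , vw , cong₂ (λ a b → neg * (a * b)) v≡pos w≡pos

triangle-sign : ∀ g a e b → signProduct (g * a ∷ e ∷ g * b ∷ []) ≡ e * (a * b)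
triangle-sign g a e b = begin
  g * a * (e * (g * b * pos))  ≡⟨ cong (λ t → g * a * (e * t)) (*-identityʳ (g * b)) ⟩
  g * a * (e * (g * b))        ≡⟨ x∙yz≈y∙xz (g * a) e (g * b) ⟩
  e * (g * a * (g * b))        ≡⟨ cong (e *_) (interchange g a g b) ⟩
  e * (g * g * (a * b))        ≡⟨ cong (λ t → e * (t * (a * b))) (s*s≡+ g) ⟩
  e * (a * b)                  ∎

module _ {n} (G : SignedGraph n) {m : Fin n → ℕ} (H : (l : Fin n) → SignedGraph (m l)) (l : Fin n) where

  corona-join : ∀ v → corona G H (inj₁ l) (inj₂ (l , v)) ≡ just (marking G l * marking (H l) v)
  corona-join v with l ≟ l
  ... | yes refl = refl
  ... | no l≢l   with () ← l≢l refl

  corona-join′ : ∀ v → corona G H (inj₂ (l , v)) (inj₁ l) ≡ just (marking G l * marking (H l) v)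
  corona-join′ v with l ≟ l
  ... | yes refl = refl
  ... | no l≢l   with () ← l≢l refl

  corona-copy : ∀ v w → corona G H (inj₂ (l , v)) (inj₂ (l , w)) ≡ adj (H l) v w
  corona-copy v w with l ≟ l
  ... | yes refl = refl
  ... | no l≢l   with () ← l≢l refl

  balanced⇒edge-respects-marking : BalancedAdj (corona G H) →
    ∀ {v w e} → adj (H l) v w ≡ just e → e * (marking (H l) v * marking (H l) w) ≡ pos
  balanced⇒edge-respects-marking balanced {v} {w} {e} vw = begin
    e * (marking (H l) v * marking (H l) w)  ≡⟨ ≡-sym (triangle-sign g a e b) ⟩
    signProduct (g * a ∷ e ∷ g * b ∷ [])     ≡⟨ triangle-positive ⟩
    pos                                      ∎
    where
    g a b : Sign
    g = marking G l
    a = marking (H l) v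
    b = marking (H l) w
    triangle-positive : signProduct (g * a ∷ e ∷ g * b ∷ []) ≡ pos
    triangle-positive = balanced⇒triangle-positive balanced
      {inj₁ l} {inj₂ (l , v)} {inj₂ (l , w)} (λ ()) (λ ())
      (λ { refl → adjacent⇒distinct (H l) vw refl })
      (corona-join v) (trans (corona-copy v w) vw) (corona-join′ w)

mainTheorem7 : (n : ℕ) (G : SignedGraph n) (m : Fin n → ℕ)
    (H : (l : Fin n) → SignedGraph (m l)) →
    Balanced G → (∀ l → Balanced (H l)) →
    ∃ (λ j → SpecialEdge (H j)) →
    ¬ BalancedAdj (corona G H)
mainTheorem7 n G m H _ _ (j , special) balanced
  with v , w , e , vw , frustrated ← specialEdge⇒frustrated (H j) special
  with () ← trans (≡-sym frustrated) (balanced⇒edge-respects-marking G H j balanced vw)
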